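{- Let $\mathcal{R}=\mathbb{F}_{q_1}\oplus\cdots\oplus\mathbb{F}_{q_r}$ and $k\ge1$. If $\mathbf{a}$ is a sequence satisfying a linear recurrence of degree $k$ over $\mathcal{R}$, then $\rho(\mathbf{a})\le\prod_{i=1}^r(q_i^k-1)$.
   Context: Here $\mathbb{F}_{q_i}$ are finite fields (possibly of different characteristics). A sequence $\mathbf{a}=(a_n)_{n\ge0}$ over $\mathcal{R}$ satisfies a linear recurrence of degree $k$ if there are $c_0,\dots,c_{k-1}\in \mathcal{R}$ with $c_0$ a unit of $\mathcal{R}$ such that $a_{n+k}=\sum_{i=0}^{k-1}c_ia_{n+i}$ for all $n\ge0$. Its period $\rho(\mathbf{a})$ is the least $m>0$ with $a_{n+m}=a_n$ for all sufficiently large $n$. -}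

module Defs where

open import Level using (Level; _⊔_)
open import Data.Nat using (ℕ; zero; suc; _≤_; _<_)
import Data.Nat as ℕ
open import Data.Fin using (Fin; fromℕ<)
import Data.Fin as Fin
open import Data.Product using (Σ; ∃; _×_; _,_)
open import Relation.Nullary using (¬_)
open import Algebra.Bundles using (CommutativeRing)
open import Function.Bundles using (Inverse)
import Relation.Binary.PropositionalEquality as ≡

record FiniteField (c ℓ : Level) : Set (Level.suc (c ⊔ ℓ)) where
  field
    commRing : CommutativeRing c ℓ
  open CommutativeRing commRing public
  field
    size    : ℕ
    0≉1     : ¬ (0# ≈ 1#)
    inverse : ∀ x → ¬ (x ≈ 0#) → ∃ λ y → x * y ≈ 1#
    card    : Inverse setoid (≡.setoid (Fin size))

module _ {c ℓ : Level} {r : ℕ} (F : Fin r → FiniteField c ℓ) where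
  open FiniteField

  R : Set c
  R = (i : Fin r) → Carrier (F i)

  _≈R_ : R → R → Set ℓ
  x ≈R y = ∀ i → _≈_ (F i) (x i) (y i)

  _*R_ : R → R → R
  (x *R y) i = _*_ (F i) (x i) (y i)

  _+R_ : R → R → R
  (x +R y) i = _+_ (F i) (x i) (y i)

  0R : R
  0R i = 0# (F i)

  1R : R
  1R i = 1# (F i)

  sumR : (n : ℕ) → (Fin n → R) → R
  sumR zero    f = 0R
  sumR (suc n) f = f Fin.zero +R sumR n (λ i → f (Fin.suc i))

  IsUnitR : R → Set (c ⊔ ℓ)
  IsUnitR x = ∃ λ y → (x *R y) ≈R 1R

  LinRec : (k : ℕ) → 1 ≤ k → (ℕ → R) → Set (c ⊔ ℓ)
  LinRec k k≥1 a =
    Σ (Fin k → R) λ cs →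
      IsUnitR (cs (fromℕ< k≥1)) ×
      (∀ n → a (n ℕ.+ k) ≈R sumR k (λ i → cs i *R a (n ℕ.+ Fin.toℕ i)))

  IsEventualPeriod : (ℕ → R) → ℕ → Set ℓ
  IsEventualPeriod a m = (0 < m) × ∃ λ N → ∀ n → N ≤ n → a (n ℕ.+ m) ≈R a n

  IsLeastPeriod : (ℕ → R) → ℕ → Set ℓ
  IsLeastPeriod a m = IsEventualPeriod a m × (∀ m' → IsEventualPeriod a m' → m ≤ m')

∏ : (r : ℕ) → (Fin r → ℕ) → ℕ
∏ zero    f = 1
∏ (suc r) f = f Fin.zero ℕ.* ∏ r (λ i → f (Fin.suc i))

-- Each coordinate of a satisfies the same recurrence over a finite field F_q, and
-- a solution is determined by any window of k consecutive terms: forwards by the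
-- recurrence, and backwards because c₀ is a unit. If some window vanishes, the
-- coordinate is identically zero. Otherwise the q^k windows starting at
-- 0, …, q^k − 1 take at most q^k − 1 nonzero values, so two of them coincide,
-- and running the recurrence backwards makes the coordinate purely periodic
-- with period at most q^k − 1. The product of these periods is a period of a,
-- below which the least eventual period is found by a bounded search.

module Submission where

open import Defs
open import Level using (Level)
open import Algebra.Bundles using (CommutativeMonoid)
import Algebra.Properties.Group as GroupProperties
import Algebra.Properties.Monoid as MonoidProperties
import Algebra.Properties.Monoid.Sum as Sum
open import Data.Nat
  using (ℕ; zero; suc; _≤_; _<_; _^_; _∸_; _+_; _*_; _%_; _/_; z≤n; s≤s; z<s; s<s; s≤s⁻¹;
         NonZero; >-nonZero; >-nonZero⁻¹)
open import Data.Nat.Properties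
  using (+-suc; +-assoc; +-identityʳ; +-commutativeSemigroup; *-mono-≤; ≤-refl; n≤1+n; ≤-trans;
         _<?_; m≤m*n; m≤n+m; m∸n≤m; m+[n∸m]≡n; m<n⇒0<n∸m; <⇒≤; <⇒≤pred; pred-mono-≤; ^-monoʳ-<;
         m≤n⇒m<n∨m≡n; allUpTo?)
open import Algebra.Properties.CommutativeSemigroup +-commutativeSemigroup using (xy∙z≈xz∙y)
open import Data.Nat.Divisibility using (_∣_; divides; m∣m*n; ∣n⇒∣m*n)
open import Data.Nat.DivMod using (m≡m%n+[m/n]*n; m%n<n)
open import Data.Fin using (Fin; toℕ; fromℕ<; punchOut; funToFin; finToFun)
open import Data.Fin.Properties
  using (toℕ<n; toℕ-fromℕ<; pigeonhole; punchOut-injective; finToFun-funToFin; all?)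
import Data.Fin as Fin
open import Data.Product using (∃; ∃₂; _×_; _,_; proj₁; proj₂)
open import Data.Sum using (inj₁; inj₂)
open import Function using (_∘_)
open import Function.Bundles using (Inverse; Injection)
open import Function.Properties.Inverse using (Inverse⇒Injection)
open import Relation.Binary using (Setoid; Decidable)
import Relation.Unary as U
open import Relation.Nullary using (yes; no; contradiction)
open import Relation.Nullary.Decidable using (_×-dec_; via-injection)
open import Relation.Binary.PropositionalEquality as ≡ using (_≡_; _≢_; cong)

∣∏ : ∀ r (f : Fin r → ℕ) i → f i ∣ ∏ r f
∣∏ (suc r) f Fin.zero    = m∣m*n (∏ r (f ∘ Fin.suc))
∣∏ (suc r) f (Fin.suc i) = ∣n⇒∣m*n (f Fin.zero) (∣∏ r (f ∘ Fin.suc) i)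

∏-mono-≤ : ∀ r {f g : Fin r → ℕ} → (∀ i → f i ≤ g i) → ∏ r f ≤ ∏ r g
∏-mono-≤ zero    f≤g = ≤-refl
∏-mono-≤ (suc r) f≤g = *-mono-≤ (f≤g Fin.zero) (∏-mono-≤ r (f≤g ∘ Fin.suc))

∏-pos : ∀ r {f : Fin r → ℕ} → (∀ i → 0 < f i) → 0 < ∏ r f
∏-pos zero    f>0 = z<s
∏-pos (suc r) f>0 = *-mono-≤ (f>0 Fin.zero) (∏-pos r (f>0 ∘ Fin.suc))

least-witness : ∀ {p} {P : U.Pred ℕ p} → U.Decidable P → ∀ {n} → P n →
                ∃ λ m → P m × (∀ m′ → P m′ → m ≤ m′)
least-witness P? Pn with P? 0
... | yes P0 = 0 , P0 , λ _ _ → z≤n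
least-witness P? {zero} P0 | no ¬P0 = contradiction P0 ¬P0
least-witness {P = P} P? {suc n} Pn | no ¬P0
  with m , Pm , least ← least-witness {P = P ∘ suc} (P? ∘ suc) Pn
  = suc m , Pm , λ { zero P0 → contradiction P0 ¬P0 ; (suc m′) Pm′ → s≤s (least m′ Pm′) }

pigeonhole-avoiding : ∀ {n} (z : Fin n) (f : Fin n → Fin n) → (∀ t → f t ≢ z) →
                      ∃₂ λ i j → i Fin.< j × f i ≡ f j
pigeonhole-avoiding {suc n} z f f≢z
  with i , j , i<j , eq ← pigeonhole ≤-refl (λ t → punchOut (f≢z t ∘ ≡.sym))
  = i , j , i<j , punchOut-injective (f≢z i ∘ ≡.sym) (f≢z j ∘ ≡.sym) eq

funToFin-injective : ∀ {m n} (u v : Fin m → Fin n) → funToFin u ≡ funToFin v → ∀ i → u i ≡ v i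
funToFin-injective u v eq i = ≡.trans (≡.sym (finToFun-funToFin u i))
  (≡.trans (cong (λ x → finToFun x i) eq) (finToFun-funToFin v i))

funToFin-cong : ∀ {m n} {u v : Fin m → Fin n} → (∀ i → u i ≡ v i) → funToFin u ≡ funToFin v
funToFin-cong {zero}  u≗v = ≡.refl
funToFin-cong {suc m} u≗v = ≡.cong₂ Fin.combine (u≗v Fin.zero) (funToFin-cong (u≗v ∘ Fin.suc))

distinct⇒1< : ∀ {n} {x y : Fin n} → x ≢ y → 1 < n
distinct⇒1< {suc zero}    {Fin.zero} {Fin.zero} x≢y = contradiction ≡.refl x≢y
distinct⇒1< {suc (suc n)} _ = s<s z<s

module _ {c ℓ} (M : CommutativeMonoid c ℓ) where
  open CommutativeMonoid M
  open MonoidProperties monoid using (insertˡ)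

  unit-cancelˡ : ∀ {x y u v} → x ∙ y ≈ ε → x ∙ u ≈ x ∙ v → u ≈ v
  unit-cancelˡ {x} {y} {u} {v} xy≈ε xu≈xv = begin
    u           ≈⟨ insertˡ yx≈ε u ⟩
    y ∙ (x ∙ u) ≈⟨ ∙-congˡ xu≈xv ⟩
    y ∙ (x ∙ v) ≈⟨ insertˡ yx≈ε v ⟨
    v           ∎
    where
    open import Relation.Binary.Reasoning.Setoid setoid
    yx≈ε : y ∙ x ≈ ε
    yx≈ε = trans (comm y x) xy≈ε

module SequencePeriods {a ℓ} (S : Setoid a ℓ) where
  open Setoid S
  open import Relation.Binary.Reasoning.Setoid S

  Periodic : (ℕ → Carrier) → ℕ → Set ℓ
  Periodic f p = ∀ n → f (n + p) ≈ f n

  EventuallyPeriodic : (ℕ → Carrier) → ℕ → Set ℓ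
  EventuallyPeriodic f m = (0 < m) × ∃ λ N → ∀ n → N ≤ n → f (n + m) ≈ f n

  LeastEventualPeriod : (ℕ → Carrier) → ℕ → Set ℓ
  LeastEventualPeriod f m = EventuallyPeriodic f m × (∀ m′ → EventuallyPeriodic f m′ → m ≤ m′)

  module _ {f : ℕ → Carrier} where

    periodic-* : ∀ {p} t → Periodic f p → Periodic f (t * p)
    periodic-* zero        per n = reflexive (cong f (+-identityʳ n))
    periodic-* {p} (suc t) per n = begin
      f (n + (p + t * p)) ≡⟨ cong f (+-assoc n p (t * p)) ⟨
      f (n + p + t * p)   ≈⟨ periodic-* t per (n + p) ⟩
      f (n + p)           ≈⟨ per n ⟩
      f n                 ∎

    periodic-∣ : ∀ {p m} → Periodic f p → p ∣ m → Periodic f m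
    periodic-∣ per (divides t ≡.refl) = periodic-* t per

    periodic⇒eventual : ∀ {m} → 0 < m → Periodic f m → EventuallyPeriodic f m
    periodic⇒eventual 0<m per = 0<m , 0 , λ n _ → per n

    module _ {P} .{{_ : NonZero P}} (per : Periodic f P) where

      eventual⇒periodic : ∀ {m} → EventuallyPeriodic f m → Periodic f m
      eventual⇒periodic {m} (_ , N , ev) n = begin
        f (n + m)         ≈⟨ periodic-* N per (n + m) ⟨
        f (n + m + N * P) ≡⟨ cong f (xy∙z≈xz∙y n m (N * P)) ⟩
        f (n + N * P + m) ≈⟨ ev (n + N * P) (≤-trans (m≤m*n N P) (m≤n+m (N * P) n)) ⟩
        f (n + N * P)     ≈⟨ periodic-* N per n ⟩
        f n               ∎

      prefix⇒periodic : ∀ {m} → (∀ {n} → n < P → f (n + m) ≈ f n) → Periodic f m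
      prefix⇒periodic {m} prefix n = begin
        f (n + m)                 ≡⟨ cong (λ x → f (x + m)) (m≡m%n+[m/n]*n n P) ⟩
        f (n % P + n / P * P + m) ≡⟨ cong f (xy∙z≈xz∙y (n % P) (n / P * P) m) ⟩
        f (n % P + m + n / P * P) ≈⟨ periodic-* (n / P) per (n % P + m) ⟩
        f (n % P + m)             ≈⟨ prefix (m%n<n n P) ⟩
        f (n % P)                 ≈⟨ periodic-* (n / P) per (n % P) ⟨
        f (n % P + n / P * P)     ≡⟨ cong f (m≡m%n+[m/n]*n n P) ⟨
        f n                       ∎

      -- A decidable stand-in for Periodic f m: thanks to the period P,
      -- it suffices to check the first P terms (see prefix⇒periodic).
      PrefixPeriod : ℕ → Set ℓ
      PrefixPeriod m = 0 < m × (∀ {n} → n < P → f (n + m) ≈ f n)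

      eventual⇒prefix : ∀ {m} → EventuallyPeriodic f m → PrefixPeriod m
      eventual⇒prefix ev = proj₁ ev , λ {n} _ → eventual⇒periodic ev n

      eventual-P : EventuallyPeriodic f P
      eventual-P = periodic⇒eventual (>-nonZero⁻¹ P) per

      module _ (_≟_ : Decidable _≈_) where

        prefix? : U.Decidable PrefixPeriod
        prefix? m = (0 <? m) ×-dec allUpTo? (λ n → f (n + m) ≟ f n) P

        least-period : ∃ λ ρ → LeastEventualPeriod f ρ × ρ ≤ P
        least-period
          with ρ , (0<ρ , prefix) , least ← least-witness {P = PrefixPeriod} prefix?
                                                         (eventual⇒prefix eventual-P)
          = ρ , (periodic⇒eventual 0<ρ (prefix⇒periodic prefix)
                , λ m ev → least m (eventual⇒prefix ev))
              , least P (eventual⇒prefix eventual-P)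

module _ {c ℓ} (F : FiniteField c ℓ) where
  open FiniteField F
    using (Carrier; _≈_; 0#; 1#; setoid; sym; trans; +-congˡ; *-congˡ; zeroʳ; +-monoid; +-group;
           *-commutativeMonoid; size; 0≉1; card)
    renaming (_+_ to _⊕_; _*_ to _⊗_)
  open import Algebra.Properties.Monoid.Sum +-monoid using (sum; sum-cong-≋; sum-replicate-zero)
  open SequencePeriods setoid using (Periodic)
  open Inverse card using (to; to-cong)

  ≈-dec : Decidable _≈_
  ≈-dec = via-injection (Inverse⇒Injection card) Fin._≟_

  1<size : 1 < size
  1<size = distinct⇒1< (0≉1 ∘ Injection.injective (Inverse⇒Injection card))

  module Recurrence (k′ : ℕ) (cs : Fin (suc k′) → Carrier)
                    (c₀⁻¹ : Carrier) (c₀c₀⁻¹≈1 : cs Fin.zero ⊗ c₀⁻¹ ≈ 1#) where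
    open import Relation.Binary.Reasoning.Setoid setoid

    k : ℕ
    k = suc k′

    record Satisfies (b : ℕ → Carrier) : Set ℓ where
      constructor satisfies
      field recurrence : ∀ n → b (n + k) ≈ sum (λ i → cs i ⊗ b (n + toℕ i))
    open Satisfies

    record Agree (b b′ : ℕ → Carrier) (i j : ℕ) : Set ℓ where
      constructor agree
      field at : ∀ l → l < k → b (i + l) ≈ b′ (j + l)
    open Agree

    agree-head : ∀ {b b′ i j} → Agree b b′ i j → b i ≈ b′ j
    agree-head {b} {b′} {i} {j} a = begin
      b i        ≡⟨ cong b (+-identityʳ i) ⟨
      b (i + 0)  ≈⟨ at a 0 z<s ⟩
      b′ (j + 0) ≡⟨ cong b′ (+-identityʳ j) ⟩
      b′ j       ∎

    module _ {b b′} (rb : Satisfies b) (rb′ : Satisfies b′) where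

      agree-suc : ∀ {i j} → Agree b b′ i j → Agree b b′ (suc i) (suc j)
      agree-suc {i} {j} a = agree step
        where
        step : ∀ l → l < k → b (suc i + l) ≈ b′ (suc j + l)
        step l l<k with m≤n⇒m<n∨m≡n (s≤s⁻¹ l<k)
        ... | inj₁ l<k′ = begin
          b (suc i + l)  ≡⟨ cong b (+-suc i l) ⟨
          b (i + suc l)  ≈⟨ at a (suc l) (s<s l<k′) ⟩
          b′ (j + suc l) ≡⟨ cong b′ (+-suc j l) ⟩
          b′ (suc j + l) ∎
        ... | inj₂ ≡.refl = begin
          b (suc i + k′)                    ≡⟨ cong b (+-suc i k′) ⟨
          b (i + k)                         ≈⟨ recurrence rb i ⟩
          sum (λ m → cs m ⊗ b (i + toℕ m))  ≈⟨ sum-cong-≋ (λ m → *-congˡ {cs m} (at a (toℕ m) (toℕ<n m))) ⟩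
          sum (λ m → cs m ⊗ b′ (j + toℕ m)) ≈⟨ recurrence rb′ j ⟨
          b′ (j + k)                        ≡⟨ cong b′ (+-suc j k′) ⟩
          b′ (suc j + k′)                   ∎

      agree-pred : ∀ {i j} → Agree b b′ (suc i) (suc j) → Agree b b′ i j
      agree-pred {i} {j} a = agree step
        where
        tail : (ℕ → Carrier) → ℕ → Carrier
        tail b i = sum (λ m → cs (Fin.suc m) ⊗ b (i + suc (toℕ m)))

        shifted : ∀ l → l < k → b (i + suc l) ≈ b′ (j + suc l)
        shifted l l<k = begin
          b (i + suc l)  ≡⟨ cong b (+-suc i l) ⟩
          b (suc i + l)  ≈⟨ at a l l<k ⟩
          b′ (suc j + l) ≡⟨ cong b′ (+-suc j l) ⟨
          b′ (j + suc l) ∎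

        tails : tail b i ≈ tail b′ j
        tails = sum-cong-≋ (λ m →
          *-congˡ {cs (Fin.suc m)} (shifted (toℕ m) (≤-trans (toℕ<n m) (n≤1+n k′))))

        heads : cs Fin.zero ⊗ b (i + 0) ⊕ tail b′ j ≈ cs Fin.zero ⊗ b′ (j + 0) ⊕ tail b′ j
        heads = begin
          cs Fin.zero ⊗ b (i + 0) ⊕ tail b′ j  ≈⟨ +-congˡ tails ⟨
          cs Fin.zero ⊗ b (i + 0) ⊕ tail b i   ≈⟨ recurrence rb i ⟨
          b (i + k)                            ≈⟨ shifted k′ ≤-refl ⟩
          b′ (j + k)                           ≈⟨ recurrence rb′ j ⟩
          cs Fin.zero ⊗ b′ (j + 0) ⊕ tail b′ j ∎

        step : ∀ l → l < k → b (i + l) ≈ b′ (j + l)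
        -- The recurrence at i and j differs only in its c₀-terms.
        step zero    _       = unit-cancelˡ *-commutativeMonoid c₀c₀⁻¹≈1
                                 (GroupProperties.∙-cancelʳ +-group _ _ _ heads)
        step (suc l) sl<k = shifted l (≤-trans (n≤1+n _) sl<k)

      agree-shift : ∀ {j} → Agree b b′ 0 j → ∀ n → Agree b b′ n (n + j)
      agree-shift a zero    = a
      agree-shift a (suc n) = agree-suc (agree-shift a n)

      agree-unshift : ∀ {j} n → Agree b b′ n (n + j) → Agree b b′ 0 j
      agree-unshift zero    a = a
      agree-unshift (suc n) a = agree-unshift n (agree-pred a)

    window : (ℕ → Carrier) → ℕ → Fin k → Fin size
    window b i l = to (b (i + toℕ l))

    window-code : (ℕ → Carrier) → ℕ → Fin (size ^ k)
    window-code b i = funToFin (window b i)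

    window-agree : ∀ {b b′ i j} → window-code b i ≡ window-code b′ j → Agree b b′ i j
    window-agree {b} {b′} {i} {j} eq = agree λ l l<k →
      ≡.subst (λ x → b (i + x) ≈ b′ (j + x)) (toℕ-fromℕ< l<k)
        (Injection.injective (Inverse⇒Injection card)
          (funToFin-injective (window b i) (window b′ j) eq (fromℕ< l<k)))

    agree-window : ∀ {b b′ i j} → Agree b b′ i j → window-code b i ≡ window-code b′ j
    agree-window a = funToFin-cong (λ l → to-cong (at a (toℕ l) (toℕ<n l)))

    zeros : ℕ → Carrier
    zeros _ = 0#

    zeros-satisfies : Satisfies zeros
    zeros-satisfies = satisfies λ n → begin
      0#                    ≈⟨ sum-replicate-zero k ⟨
      sum {k} (λ _ → 0#)    ≈⟨ sum-cong-≋ (λ i → zeroʳ (cs i)) ⟨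
      sum (λ i → cs i ⊗ 0#) ∎

    module _ {b} (rb : Satisfies b) where

      vanishing : window-code b 0 ≡ window-code zeros 0 → ∀ n → b n ≈ 0#
      vanishing w≡0 n =
        agree-head (agree-shift rb zeros-satisfies (window-agree {b} {zeros} {0} {0} w≡0) n)

      nonvanishing : window-code b 0 ≢ window-code zeros 0 →
                     ∀ t → window-code b t ≢ window-code zeros 0
      nonvanishing w≢0 t wt≡0 =
        w≢0 (agree-window (agree-unshift rb zeros-satisfies t vanishes-at-t))
        where
        -- zeros is constant, so the second index of Agree b zeros is irrelevant.
        vanishes-at-t : Agree b zeros t (t + 0)
        vanishes-at-t = agree (at (window-agree {b} {zeros} {t} {0} wt≡0))

      repeated-window⇒periodic : ∀ {i j} → i < j → window-code b i ≡ window-code b j →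
                                 Periodic b (j ∸ i)
      repeated-window⇒periodic {i} {j} i<j wi≡wj n =
        sym (agree-head (agree-shift rb rb from-start n))
        where
        from-start : Agree b b 0 (j ∸ i)
        from-start = agree-unshift rb rb i
          (≡.subst (Agree b b i) (≡.sym (m+[n∸m]≡n (<⇒≤ i<j))) (window-agree wi≡wj))

      satisfies⇒periodic : ∃ λ p → 0 < p × p ≤ size ^ k ∸ 1 × Periodic b p
      satisfies⇒periodic with window-code b 0 Fin.≟ window-code zeros 0
      ... | yes w≡0 = 1 , z<s , pred-mono-≤ (^-monoʳ-< size 1<size {0} {k} z<s) , λ n →
            trans (vanishing w≡0 (n + 1)) (sym (vanishing w≡0 n))
      ... | no w≢0
        with i , j , i<j , wi≡wj ← pigeonhole-avoiding (window-code zeros 0) (window-code b ∘ toℕ)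
                                                       (nonvanishing w≢0 ∘ toℕ)
        = toℕ j ∸ toℕ i , m<n⇒0<n∸m i<j , ≤-trans (m∸n≤m (toℕ j) (toℕ i)) (<⇒≤pred (toℕ<n j))
        , repeated-window⇒periodic i<j wi≡wj

setoidR : ∀ {c ℓ r} → (Fin r → FiniteField c ℓ) → Setoid c ℓ
setoidR F = record
  { Carrier       = R F
  ; _≈_           = _≈R_ F
  ; isEquivalence = record
    { refl  = λ i → FiniteField.refl (F i)
    ; sym   = λ x≈y i → FiniteField.sym (F i) (x≈y i)
    ; trans = λ x≈y y≈z i → FiniteField.trans (F i) (x≈y i) (y≈z i)
    }
  }

≈R-dec : ∀ {c ℓ r} (F : Fin r → FiniteField c ℓ) → Decidable (_≈R_ F)
≈R-dec F x y = all? (λ i → ≈-dec (F i) (x i) (y i))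

sumR-component : ∀ {c ℓ r} (F : Fin r → FiniteField c ℓ) n (f : Fin n → R F) i →
                 sumR F n f i ≡ Sum.sum (FiniteField.+-monoid (F i)) (λ m → f m i)
sumR-component F zero    f i = ≡.refl
sumR-component F (suc n) f i =
  cong (FiniteField._+_ (F i) (f Fin.zero i)) (sumR-component F n (f ∘ Fin.suc) i)

lemma4p5 : {c ℓ : Level} (r : ℕ) (F : Fin r → FiniteField c ℓ) (k : ℕ) (k≥1 : 1 ≤ k)
    (a : ℕ → R F) → LinRec F k k≥1 a →
    ∃ λ ρ → IsLeastPeriod F a ρ × ρ ≤ ∏ r (λ i → FiniteField.size (F i) ^ k ∸ 1)
lemma4p5 r F (suc k′) (s≤s z≤n) a (cs , (c₀⁻¹ , c₀c₀⁻¹≈1) , rec) =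
  let ρ , isLeast , ρ≤∏p = least-period (setoidR F) a-periodic (≈R-dec F)
  in  ρ , isLeast , ≤-trans ρ≤∏p (∏-mono-≤ r p≤bound)
  where
  open SequencePeriods using (Periodic; periodic-∣; least-period)
  open FiniteField using (size; setoid)

  component-period : ∀ i → ∃ λ p → 0 < p × p ≤ size (F i) ^ suc k′ ∸ 1
                                 × Periodic (setoid (F i)) (λ n → a n i) p
  component-period i = satisfies⇒periodic (satisfies λ n →
      ≡.subst (FiniteField._≈_ (F i) (a (n + suc k′) i))
              (sumR-component F (suc k′) (λ m → _*R_ F (cs m) (a (n + toℕ m))) i)
              (rec n i))
    where open Recurrence (F i) k′ (λ m → cs m i) (c₀⁻¹ i) (c₀c₀⁻¹≈1 i)

  p : Fin r → ℕ
  p i = proj₁ (component-period i)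

  p>0 : ∀ i → 0 < p i
  p>0 i = proj₁ (proj₂ (component-period i))

  p≤bound : ∀ i → p i ≤ size (F i) ^ suc k′ ∸ 1
  p≤bound i = proj₁ (proj₂ (proj₂ (component-period i)))

  instance
    ∏p≢0 : NonZero (∏ r p)
    ∏p≢0 = >-nonZero (∏-pos r p>0)

  a-periodic : Periodic (setoidR F) a (∏ r p)
  a-periodic n i =
    periodic-∣ (setoid (F i)) (proj₂ (proj₂ (proj₂ (component-period i)))) (∣∏ r p i) n
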